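{- Let $G$ be a directed acyclic graph with $s,t\in V(G)$, where $s$ has out-degree at least $2$. Then the minimum cardinality of a forcing set for $\mathcal{P}_t$ equals $\min\{\mathrm{OPT}[v] : v\in V(G),\ v\Rightarrow t\}$.
   Context: For $v\in V(G)$, $\mathcal{P}_v$ is the set of all directed paths from $s$ to $v$ in $G$. A set $S\subseteq E(G)$ is a forcing set for $\mathcal{P}_v$ if there is exactly one $P\in\mathcal{P}_v$ with $S\subseteq E(P)$. For vertices $x,y$, $x\Rightarrow y$ means there is exactly one directed path from $x$ to $y$ in $G$ (so $x\Rightarrow x$ always). For an edge $e=(u,v)$, $\mathrm{OPT}[e]=\min\{|S| : S \text{ is a forcing set for } \mathcal{P}_v \text{ with } e\in S\}$; for $v\neq s$, $\mathrm{OPT}[v]=\min_{u\in N^-(v)}\mathrm{OPT}[(u,v)]$, where $N^-(v)$ is the set of in-neighbors of $v$; and $\mathrm{OPT}[s]=0$. A minimum over an empty set is $\infty$. -}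

module Defs where

open import Data.Nat using (ℕ; zero; suc; _≤_)
open import Data.Fin using (Fin)
open import Data.Bool using (Bool; true; false; if_then_else_)
open import Data.List using (List; []; _∷_; map; allFin)
open import Data.Nat.ListAction using (sum)
open import Data.List.Relation.Unary.Unique.Propositional using (Unique)
open import Data.Product using (Σ; ∃; _×_; _,_)
open import Data.Sum using (_⊎_)
open import Relation.Binary.PropositionalEquality using (_≡_; _≢_)

data ℕ∞ : Set where
  fin : ℕ → ℕ∞
  ∞   : ℕ∞

data _≤∞_ : ℕ∞ → ℕ∞ → Set where
  fin≤fin : ∀ {m k} → m ≤ k → fin m ≤∞ fin k
  _≤∞∞    : ∀ x → x ≤∞ ∞

-- o is the minimum of the set A ⊆ ℕ∞ (with min ∅ = ∞):
-- o is a lower bound of A, and o ∈ A or o = ∞.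
IsMin : (ℕ∞ → Set) → ℕ∞ → Set
IsMin A o = (∀ x → A x → o ≤∞ x) × (A o ⊎ o ≡ ∞)

Digraph : ℕ → Set
Digraph n = Fin n → Fin n → Bool

EdgeSet : ℕ → Set
EdgeSet n = Fin n → Fin n → Bool

module _ {n : ℕ} (G : Digraph n) where

  data Walk : Fin n → Fin n → List (Fin n) → Set where
    stop : ∀ {x} → Walk x x (x ∷ [])
    step : ∀ {x y z ys} → G x y ≡ true → Walk y z ys → Walk x z (x ∷ ys)

  IsPath : Fin n → Fin n → List (Fin n) → Set
  IsPath x y xs = Walk x y xs × Unique xs

  Acyclic : Set
  Acyclic = ∀ x xs → Walk x x xs → xs ≡ x ∷ []

  _⇒_ : Fin n → Fin n → Set
  x ⇒ y = Σ (List (Fin n)) λ P → IsPath x y P × (∀ Q → IsPath x y Q → Q ≡ P)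

  card : EdgeSet n → ℕ
  card S = sum (map (λ u → sum (map (λ v → if S u v then 1 else 0) (allFin n))) (allFin n))

  outdeg : Fin n → ℕ
  outdeg u = sum (map (λ v → if G u v then 1 else 0) (allFin n))

data EdgeOf {n : ℕ} : List (Fin n) → Fin n → Fin n → Set where
  here  : ∀ {u v xs} → EdgeOf (u ∷ v ∷ xs) u v
  there : ∀ {x u v xs} → EdgeOf xs u v → EdgeOf (x ∷ xs) u v

module _ {n : ℕ} (G : Digraph n) (s : Fin n) where

  _⊆E[_] : EdgeSet n → List (Fin n) → Set
  S ⊆E[ P ] = ∀ u v → S u v ≡ true → EdgeOf P u v

  IsForcingSet : Fin n → EdgeSet n → Set
  IsForcingSet v S =
    (∀ a b → S a b ≡ true → G a b ≡ true) ×
    Σ (List (Fin n)) λ P → (IsPath G s v P × S ⊆E[ P ]) ×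
      (∀ Q → IsPath G s v Q → S ⊆E[ Q ] → Q ≡ P)

  IsOPTedge : Fin n → Fin n → ℕ∞ → Set
  IsOPTedge u v = IsMin (λ x → ∃ λ S → IsForcingSet v S × S u v ≡ true × x ≡ fin (card G S))

  IsOPT : Fin n → ℕ∞ → Set
  IsOPT v o = (v ≡ s → o ≡ fin 0) ×
              (v ≢ s → IsMin (λ x → ∃ λ u → G u v ≡ true × IsOPTedge u v x) o)

-- In a DAG every walk is a path, so a path can be glued from an s–v path and
-- the unique v–t path. If S forces the s–v path and contains an edge entering v,
-- then S also forces the glued s–t path: an s–t path Q through that edge passes
-- through v, the S-edges of Q all lie before v (otherwise a cycle appears), so the
-- s–v part of Q is forced and the v–t part is unique. Conversely, let S force the
-- s–t path P. If S is empty, P is the only s–t path and s ⇒ t with OPT[s] = 0.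
-- Otherwise let (u , v) be the last S-edge of P: the part of P after v is the
-- unique v–t path, and S forces the part before v. So each OPT[v] with v ⇒ t is
-- the size of a forcing set for 𝒫_t, and a minimum one has size OPT[v] for its
-- last forced vertex v. That minimum exists because there are finitely many edge
-- sets and being a forcing set is decidable (paths have at most n vertices).
module Submission where

open import Defs
open import Data.Nat using (ℕ; zero; suc; _≥_; _≤_; _≤?_; s≤s)
open import Data.Nat.Properties using (≤-refl; ≤-trans; ≤-total; ≰⇒>)
open import Data.Nat.ListAction using (sum)
open import Data.Fin using (Fin; zero; suc) renaming (_≟_ to _≟ᶠ_)
import Data.Fin as Fin
open import Data.Fin.Properties using (pigeonhole; all?)
open import Data.Bool using (true; false; if_then_else_) renaming (_≟_ to _≟ᵇ_)
open import Data.Bool.Properties using (¬-not)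
open import Data.List using (List; []; _∷_; _++_; map; allFin; length; lookup; filter; cartesianProductWith)
open import Data.List.Properties using (∷-injectiveʳ; ++-cancelˡ; ++-cancelʳ; map-cong; ≡-dec)
open import Data.List.Relation.Unary.Unique.Propositional using (Unique)
open import Data.List.Relation.Unary.AllPairs using ([]; _∷_)
open import Data.List.Relation.Unary.All as All using (All; []; _∷_)
open import Data.List.Relation.Unary.Any using (Any; here; there; any?)
open import Data.List.Membership.Propositional using (_∈_; find; lose)
open import Data.List.Membership.Propositional.Properties
  using (∈-allFin; ∈-lookup; ∈-filter⁺; ∈-filter⁻; ∈-cartesianProductWith⁺)
open import Data.Vec.Functional using () renaming (_∷_ to _∷ᶠ_)
open import Data.Product using (∃; ∃₂; _×_; _,_; proj₁; proj₂)
open import Data.Sum using (_⊎_; inj₁; inj₂; [_,_]′; map₁)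
open import Data.Empty using (⊥-elim)
open import Relation.Nullary using (Dec; yes; no; ¬_)
open import Relation.Nullary.Decidable using (map′; _×-dec_; _⊎-dec_; _→-dec_)
open import Relation.Binary.PropositionalEquality using (_≡_; _≢_; refl; sym; trans; cong; cong₂; subst)

≤∞-refl : ∀ {x} → x ≤∞ x
≤∞-refl {fin m} = fin≤fin ≤-refl
≤∞-refl {∞}     = ∞ ≤∞∞

≤∞-trans : ∀ {x y z} → x ≤∞ y → y ≤∞ z → x ≤∞ z
≤∞-trans {x} _       (_ ≤∞∞)     = x ≤∞∞
≤∞-trans (fin≤fin p) (fin≤fin q) = fin≤fin (≤-trans p q)

≤∞-total : ∀ x y → x ≤∞ y ⊎ y ≤∞ x
≤∞-total (fin a) (fin b) = [ (λ a≤b → inj₁ (fin≤fin a≤b)) , (λ b≤a → inj₂ (fin≤fin b≤a)) ]′ (≤-total a b)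
≤∞-total x       ∞       = inj₁ (x ≤∞∞)
≤∞-total ∞       (fin b) = inj₂ (fin b ≤∞∞)

IsMin-≤ : ∀ {A o x} → IsMin A o → x ≡ ∞ ⊎ A x → o ≤∞ x
IsMin-≤ _           (inj₁ refl) = _ ≤∞∞
IsMin-≤ (lower , _) (inj₂ Ax)   = lower _ Ax

module _ {E : Set} {P : E → Set} (P? : ∀ e → Dec (P e)) (cost : E → ℕ) where

  CostIn : List E → ℕ∞ → Set
  CostIn es x = ∃ λ e → e ∈ es × P e × x ≡ fin (cost e)

  CostIn-there : ∀ {e es x} → CostIn es x → CostIn (e ∷ es) x
  CostIn-there (e′ , e′∈ , Pe′ , x≡) = e′ , there e′∈ , Pe′ , x≡

  IsMin-∈ : (es : List E) → ∃ (IsMin (CostIn es))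
  IsMin-∈ [] = ∞ , (λ { _ (_ , () , _) }) , inj₂ refl
  IsMin-∈ (e ∷ es) with IsMin-∈ es | P? e
  ... | m , lower , attained | no ¬Pe =
    m , (λ { _ (_ , here refl , Pe , _) → ⊥-elim (¬Pe Pe)
           ; x (e′ , there e′∈ , rest) → lower x (e′ , e′∈ , rest) })
      , map₁ CostIn-there attained
  ... | m , lower , attained | yes Pe with ≤∞-total (fin (cost e)) m
  ...   | inj₁ e≤m =
    fin (cost e) , (λ { _ (_ , here refl , _ , refl) → ≤∞-refl
                      ; x (e′ , there e′∈ , rest) → ≤∞-trans e≤m (lower x (e′ , e′∈ , rest)) })
                 , inj₁ (e , here refl , Pe , refl)
  ...   | inj₂ m≤e =
    m , (λ { _ (_ , here refl , _ , refl) → m≤e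
           ; x (e′ , there e′∈ , rest) → lower x (e′ , e′∈ , rest) })
      , map₁ CostIn-there attained

  IsMin-covered : (es : List E) → (∀ e → P e → ∃ λ e′ → e′ ∈ es × P e′ × cost e′ ≡ cost e) →
                  ∃ (IsMin (λ x → ∃ λ e → P e × x ≡ fin (cost e)))
  IsMin-covered es cover with IsMin-∈ es
  ... | m , lower , attained =
    m , (λ { x (e , Pe , refl) → let e′ , e′∈ , Pe′ , same = cover e Pe in
                                 subst (λ c → m ≤∞ fin c) same (lower _ (e′ , e′∈ , Pe′ , refl)) })
      , [ (λ (e , _ , Pe , m≡) → inj₁ (e , Pe , m≡)) , inj₂ ]′ attained

allFunctions : ∀ {B : Set} → List B → (m : ℕ) → List (Fin m → B)
allFunctions bs zero    = (λ ()) ∷ []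
allFunctions bs (suc m) = cartesianProductWith _∷ᶠ_ bs (allFunctions bs m)

allFunctions-complete : ∀ {B : Set} (R : B → B → Set) (bs : List B) →
  (∀ b → ∃ λ b′ → b′ ∈ bs × R b′ b) →
  ∀ m (g : Fin m → B) → ∃ λ f → f ∈ allFunctions bs m × (∀ i → R (f i) (g i))
allFunctions-complete R bs cover zero g = (λ ()) , here refl , λ ()
allFunctions-complete R bs cover (suc m) g
  with cover (g zero) | allFunctions-complete R bs cover m (λ i → g (suc i))
... | b , b∈ , Rb | f , f∈ , Rf =
  b ∷ᶠ f , ∈-cartesianProductWith⁺ _∷ᶠ_ b∈ f∈ , λ { zero → Rb ; (suc i) → Rf i }

allEdgeSets : (n : ℕ) → List (EdgeSet n)
allEdgeSets n = allFunctions (allFunctions (true ∷ false ∷ []) n) n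

allEdgeSets-complete : ∀ n (S : EdgeSet n) → ∃ λ S′ → S′ ∈ allEdgeSets n × (∀ a b → S′ a b ≡ S a b)
allEdgeSets-complete n =
  allFunctions-complete (λ f g → ∀ j → f j ≡ g j) _
    (allFunctions-complete _≡_ _ (λ { true → true , here refl , refl
                                    ; false → false , there (here refl) , refl }) n) n

listsUpTo : ∀ {n} → ℕ → List (List (Fin n))
listsUpTo zero        = [] ∷ []
listsUpTo {n} (suc k) = [] ∷ cartesianProductWith _∷_ (allFin n) (listsUpTo k)

listsUpTo-complete : ∀ {n} k (xs : List (Fin n)) → length xs ≤ k → xs ∈ listsUpTo k
listsUpTo-complete zero    []       _         = here refl
listsUpTo-complete (suc k) []       _         = here refl
listsUpTo-complete (suc k) (x ∷ xs) (s≤s len) =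
  there (∈-cartesianProductWith⁺ _∷_ (∈-allFin x) (listsUpTo-complete k xs len))

Unique-lookup-injective : ∀ {A : Set} {xs : List A} → Unique xs →
  ∀ {i j : Fin (length xs)} → i Fin.< j → lookup xs i ≢ lookup xs j
Unique-lookup-injective (x∉xs ∷ _) {zero}  {suc j} _         = All.lookup x∉xs (∈-lookup j)
Unique-lookup-injective (_ ∷ uniq) {suc i} {suc j} (s≤s i<j) = Unique-lookup-injective uniq i<j

Unique⇒length≤ : ∀ {n} {xs : List (Fin n)} → Unique xs → length xs ≤ n
Unique⇒length≤ {n} {xs} uniq with length xs ≤? n
... | yes len≤n = len≤n
... | no  len≰n =
  let i , j , i<j , same = pigeonhole (≰⇒> len≰n) (lookup xs) in
  ⊥-elim (Unique-lookup-injective uniq i<j same)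

EdgeOf-source : ∀ {n} {xs : List (Fin n)} {a b} → EdgeOf xs a b → a ∈ xs
EdgeOf-source here      = here refl
EdgeOf-source (there e) = there (EdgeOf-source e)

EdgeOf-target : ∀ {n} {xs : List (Fin n)} {a b} → EdgeOf xs a b → b ∈ xs
EdgeOf-target here      = there (here refl)
EdgeOf-target (there e) = there (EdgeOf-target e)

EdgeOf-++ˡ : ∀ {n} {xs ys : List (Fin n)} {a b} → EdgeOf xs a b → EdgeOf (xs ++ ys) a b
EdgeOf-++ˡ here      = here
EdgeOf-++ˡ (there e) = there (EdgeOf-++ˡ e)

edgeOf? : ∀ {n} (xs : List (Fin n)) (a b : Fin n) → Dec (EdgeOf xs a b)
edgeOf? []           a b = no λ ()
edgeOf? (x ∷ [])     a b = no λ { (there ()) }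
edgeOf? (x ∷ y ∷ xs) a b =
  map′ [ (λ { (refl , refl) → here }) , there ]′ (λ { here → inj₁ (refl , refl) ; (there e) → inj₂ e })
       ((x ≟ᶠ a ×-dec y ≟ᶠ b) ⊎-dec edgeOf? (y ∷ xs) a b)

card-cong : ∀ {n} (G : Digraph n) {S S′ : EdgeSet n} → (∀ a b → S′ a b ≡ S a b) → card G S′ ≡ card G S
card-cong {n} G same =
  cong sum (map-cong (λ a → cong sum (map-cong (λ b → cong (λ β → if β then 1 else 0) (same a b))
                                               (allFin n))) (allFin n))

sum-map-zero : ∀ {A : Set} {f : A → ℕ} → (∀ x → f x ≡ 0) → ∀ xs → sum (map f xs) ≡ 0
sum-map-zero f≡0 []       = refl
sum-map-zero f≡0 (x ∷ xs) rewrite f≡0 x = sum-map-zero f≡0 xs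

card-empty : ∀ {n} (G : Digraph n) {S : EdgeSet n} → (∀ a b → S a b ≡ false) → card G S ≡ 0
card-empty {n} G empty =
  sum-map-zero (λ a → sum-map-zero (λ b → cong (λ β → if β then 1 else 0) (empty a b)) (allFin n)) (allFin n)

IsForcingSet-cong : ∀ {n} (G : Digraph n) s t {S S′ : EdgeSet n} → (∀ a b → S′ a b ≡ S a b) →
                    IsForcingSet G s t S → IsForcingSet G s t S′
IsForcingSet-cong G s t same (S⊆G , P , (path , S⊆P) , P-unique) =
  (λ a b S′ab → S⊆G a b (trans (sym (same a b)) S′ab)) , P ,
  (path , λ a b S′ab → S⊆P a b (trans (sym (same a b)) S′ab)) ,
  λ Q pathQ S′⊆Q → P-unique Q pathQ (λ a b Sab → S′⊆Q a b (trans (same a b) Sab))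

module Walks {n : ℕ} (G : Digraph n) where

  _↝_ : Fin n → Fin n → Set
  x ↝ y = ∃ (Walk G x y)

  walk-∷ : ∀ {x y xs} → Walk G x y xs → ∃ λ xs′ → xs ≡ x ∷ xs′
  walk-∷ stop       = [] , refl
  walk-∷ (step _ w) = _ , refl

  walk-++ : ∀ {x v y p q} → Walk G x v p → Walk G v y (v ∷ q) → Walk G x y (p ++ q)
  walk-++ stop       w′ = w′
  walk-++ (step e w) w′ = step e (walk-++ w w′)

  ↝-trans : ∀ {x y z} → x ↝ y → y ↝ z → x ↝ z
  ↝-trans (_ , w) (ys , w′) with walk-∷ w′
  ... | _ , refl = _ , walk-++ w w′

  split-at : ∀ {x y v xs} → Walk G x y xs → v ∈ xs →
             ∃₂ λ p q → Walk G x v p × Walk G v y (v ∷ q) × xs ≡ p ++ q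
  split-at stop       (here refl)  = _ , [] , stop , stop , refl
  split-at (step e w) (here refl)  = _ , _ , stop , step e w , refl
  split-at (step e w) (there v∈xs) with split-at w v∈xs
  ... | p , q , wp , wq , xs≡ = _ ∷ p , q , step e wp , wq , cong (_ ∷_) xs≡

  ∈-walk⇒↝ : ∀ {x y v xs} → Walk G x y xs → v ∈ xs → x ↝ v × v ↝ y
  ∈-walk⇒↝ w v∈xs with split-at w v∈xs
  ... | _ , _ , wp , wq , _ = (_ , wp) , (_ , wq)

  EdgeOf-∷⁻ : ∀ {x y z xs a b} → Walk G y z xs → EdgeOf (x ∷ xs) a b → (a ≡ x × b ≡ y) ⊎ EdgeOf xs a b
  EdgeOf-∷⁻ stop       here      = inj₁ (refl , refl)
  EdgeOf-∷⁻ (step _ _) here      = inj₁ (refl , refl)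
  EdgeOf-∷⁻ _          (there e) = inj₂ e

  EdgeOf-++⁻ : ∀ {x v p q a b} → Walk G x v p → EdgeOf (p ++ q) a b → EdgeOf p a b ⊎ EdgeOf (v ∷ q) a b
  EdgeOf-++⁻ stop                here      = inj₂ here
  EdgeOf-++⁻ stop                (there e) = inj₂ (there e)
  EdgeOf-++⁻ (step _ stop)       here      = inj₁ here
  EdgeOf-++⁻ (step _ (step _ _)) here      = inj₁ here
  EdgeOf-++⁻ (step _ w)          (there e) = [ (λ e′ → inj₁ (there e′)) , inj₂ ]′ (EdgeOf-++⁻ w e)

  walkFrom? : ∀ x y xs → Dec (Walk G x y (x ∷ xs))
  walkFrom? x y []       = map′ (λ { refl → stop }) (λ { stop → refl ; (step _ ()) }) (x ≟ᶠ y)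
  walkFrom? x y (z ∷ xs) =
    map′ (λ (e , w) → step e w) (λ { (step e stop) → e , stop ; (step e (step e′ w)) → e , step e′ w })
         (G x z ≟ᵇ true ×-dec walkFrom? z y xs)

  walk? : ∀ x y xs → Dec (Walk G x y xs)
  walk? x y []       = no λ ()
  walk? x y (z ∷ xs) with z ≟ᶠ x
  ... | yes refl = walkFrom? x y xs
  ... | no  z≢x  = no λ { stop → z≢x refl ; (step _ _) → z≢x refl }

module DAG {n : ℕ} (G : Digraph n) (acyclic : Acyclic G) (s : Fin n) where
  open Walks G

  _⊆ᴱ_ : EdgeSet n → List (Fin n) → Set
  S ⊆ᴱ P = _⊆E[_] G s S P

  edge⇒¬↝ : ∀ {a b} → G a b ≡ true → ¬ (b ↝ a)
  edge⇒¬↝ e (_ , w) with w | acyclic _ _ (step e w)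
  ... | stop     | ()
  ... | step _ _ | ()

  walk⇒path : ∀ {x y xs} → Walk G x y xs → IsPath G x y xs
  walk⇒path w = w , unique w
    where
    unique : ∀ {x y xs} → Walk G x y xs → Unique xs
    unique stop       = [] ∷ []
    unique (step e w) = All.tabulate (λ { z∈ refl → edge⇒¬↝ e (proj₁ (∈-walk⇒↝ w z∈)) }) ∷ unique w

  EdgeOf-before : ∀ {x v y p q a b} → Walk G x v p → Walk G v y (v ∷ q) →
                  G a b ≡ true → b ↝ v → EdgeOf (p ++ q) a b → EdgeOf p a b
  EdgeOf-before wp wq ab b↝v e with EdgeOf-++⁻ wp e
  ... | inj₁ e′ = e′
  ... | inj₂ e′ = ⊥-elim (edge⇒¬↝ ab (↝-trans b↝v (proj₁ (∈-walk⇒↝ wq (EdgeOf-source e′)))))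

  forcing-extend : ∀ {u v t S} → _⇒_ G v t → IsForcingSet G s v S → S u v ≡ true → IsForcingSet G s t S
  forcing-extend {u} {v} {t} {S} (R , (wR , _) , R-unique) (S⊆G , P , ((wP , _) , S⊆P) , P-unique) Suv
    with walk-∷ wR
  ... | R′ , refl =
    S⊆G , P ++ R′ , (walk⇒path (walk-++ wP wR) , λ a b Sab → EdgeOf-++ˡ (S⊆P a b Sab)) , forced
    where
    forced : ∀ Q → IsPath G s t Q → S ⊆ᴱ Q → Q ≡ P ++ R′
    forced Q (wQ , _) S⊆Q with split-at wQ (EdgeOf-target (S⊆Q u v Suv))
    ... | Q₁ , Q₂ , w₁ , w₂ , refl =
      cong₂ _++_ (P-unique Q₁ (walk⇒path w₁) S⊆Q₁) (∷-injectiveʳ (R-unique (v ∷ Q₂) (walk⇒path w₂)))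
      where
      S⊆Q₁ : S ⊆ᴱ Q₁
      S⊆Q₁ a b Sab = EdgeOf-before w₁ w₂ (S⊆G a b Sab)
                       (proj₂ (∈-walk⇒↝ wP (EdgeOf-target (S⊆P a b Sab)))) (S⊆Q a b Sab)

  Avoids : EdgeSet n → List (Fin n) → Set
  Avoids S xs = ∀ a b → S a b ≡ true → ¬ EdgeOf xs a b

  record LastEdge (S : EdgeSet n) (x y : Fin n) (xs : List (Fin n)) : Set where
    constructor lastEdge
    field
      {u v}  : Fin n
      {p q}  : List (Fin n)
      S-uv   : S u v ≡ true
      uv∈p   : EdgeOf p u v
      walk-p : Walk G x v p
      walk-q : Walk G v y (v ∷ q)
      q-free : Avoids S (v ∷ q)
      split  : xs ≡ p ++ q

  avoids⊎lastEdge : ∀ S {x y xs} → Walk G x y xs → Avoids S xs ⊎ LastEdge S x y xs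
  avoids⊎lastEdge S stop = inj₁ λ { _ _ _ (there ()) }
  avoids⊎lastEdge S (step {x} {y′} e w) with avoids⊎lastEdge S w | S x y′ in Sxy | walk-∷ w
  ... | inj₂ (lastEdge Suv uv∈p wp wq free split) | _ | _ =
    inj₂ (lastEdge Suv (there uv∈p) (step e wp) wq free (cong (x ∷_) split))
  ... | inj₁ free | true  | _ , refl = inj₂ (lastEdge Sxy here (step e stop) w free refl)
  ... | inj₁ free | false | _ = inj₁ free′
    where
    free′ : Avoids S (x ∷ _)
    free′ a b Sab ab with EdgeOf-∷⁻ w ab
    ... | inj₁ (refl , refl) with () ← trans (sym Sab) Sxy
    ... | inj₂ ab′ = free a b Sab ab′

  forcing-lastEdge : ∀ {t S} → IsForcingSet G s t S →
    (_⇒_ G s t × (∀ a b → S a b ≡ false)) ⊎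
    (∃₂ λ u v → S u v ≡ true × _⇒_ G v t × IsForcingSet G s v S × v ≢ s)
  forcing-lastEdge {t} {S} (S⊆G , P , ((wP , _) , S⊆P) , P-unique) with avoids⊎lastEdge S wP
  ... | inj₁ free =
    inj₁ ((P , walk⇒path wP ,
           λ Q pathQ → P-unique Q pathQ (λ a b Sab → ⊥-elim (free a b Sab (S⊆P a b Sab)))) ,
          λ a b → ¬-not (λ Sab → free a b Sab (S⊆P a b Sab)))
  ... | inj₂ (lastEdge {u} {v} {p} {q} Suv uv∈p wp wq free refl) =
    inj₂ (u , v , Suv , v⇒t , (S⊆G , p , (walk⇒path wp , S⊆p) , p-forced) , v≢s)
    where
    S⊆p : S ⊆ᴱ p
    S⊆p a b Sab = [ (λ e → e) , (λ e → ⊥-elim (free a b Sab e)) ]′ (EdgeOf-++⁻ wp (S⊆P a b Sab))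

    v⇒t : _⇒_ G v t
    v⇒t = v ∷ q , walk⇒path wq , λ { R (wR , _) → glued R wR (walk-∷ wR) }
      where
      glued : ∀ R → Walk G v t R → (∃ λ R′ → R ≡ v ∷ R′) → R ≡ v ∷ q
      glued _ wR (R′ , refl) =
        cong (v ∷_) (++-cancelˡ p R′ q
          (P-unique (p ++ R′) (walk⇒path (walk-++ wp wR)) (λ a b Sab → EdgeOf-++ˡ (S⊆p a b Sab))))

    p-forced : ∀ Q → IsPath G s v Q → S ⊆ᴱ Q → Q ≡ p
    p-forced Q (wQ , _) S⊆Q =
      ++-cancelʳ q Q p (P-unique (Q ++ q) (walk⇒path (walk-++ wQ wq)) (λ a b Sab → EdgeOf-++ˡ (S⊆Q a b Sab)))

    v≢s : v ≢ s
    v≢s refl = edge⇒¬↝ (S⊆G u v Suv) (proj₁ (∈-walk⇒↝ wp (EdgeOf-source uv∈p)))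

  walks : Fin n → Fin n → List (List (Fin n))
  walks x y = filter (walk? x y) (listsUpTo n)

  walks-sound : ∀ {x y xs} → xs ∈ walks x y → Walk G x y xs
  walks-sound xs∈ = proj₂ (∈-filter⁻ (walk? _ _) {xs = listsUpTo n} xs∈)

  walks-complete : ∀ {x y xs} → Walk G x y xs → xs ∈ walks x y
  walks-complete {xs = xs} w =
    ∈-filter⁺ (walk? _ _) (listsUpTo-complete n xs (Unique⇒length≤ (proj₂ (walk⇒path w)))) w

  isForcingSet? : ∀ t S → Dec (IsForcingSet G s t S)
  isForcingSet? t S =
    map′ to from
      (all? (λ a → all? (λ b → S a b ≟ᵇ true →-dec G a b ≟ᵇ true)) ×-dec
       any? (λ P → S⊆? P ×-dec All.all? (λ Q → S⊆? Q →-dec ≡-dec _≟ᶠ_ Q P) (walks s t)) (walks s t))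
    where
    S⊆? : ∀ P → Dec (S ⊆ᴱ P)
    S⊆? P = all? (λ a → all? (λ b → S a b ≟ᵇ true →-dec edgeOf? P a b))

    Witnessed : Set
    Witnessed = (∀ a b → S a b ≡ true → G a b ≡ true) ×
                Any (λ P → S ⊆ᴱ P × All (λ Q → S ⊆ᴱ Q → Q ≡ P) (walks s t)) (walks s t)

    to : Witnessed → IsForcingSet G s t S
    to (S⊆G , some) with find some
    ... | P , P∈ , S⊆P , P-forced =
      S⊆G , P , (walk⇒path (walks-sound P∈) , S⊆P) ,
      λ Q (wQ , _) S⊆Q → All.lookup P-forced (walks-complete wQ) S⊆Q

    from : IsForcingSet G s t S → Witnessed
    from (S⊆G , P , ((wP , _) , S⊆P) , P-unique) =
      S⊆G , lose (walks-complete wP)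
                 (S⊆P , All.tabulate (λ Q∈ S⊆Q → P-unique _ (walk⇒path (walks-sound Q∈)) S⊆Q))

  ForcingCard : Fin n → ℕ∞ → Set
  ForcingCard t x = ∃ λ S → IsForcingSet G s t S × x ≡ fin (card G S)

  forcingMin : ∀ t → ∃ (IsMin (ForcingCard t))
  forcingMin t = IsMin-covered (isForcingSet? t) (card G) (allEdgeSets n) cover
    where
    cover : ∀ S → IsForcingSet G s t S →
            ∃ λ S′ → S′ ∈ allEdgeSets n × IsForcingSet G s t S′ × card G S′ ≡ card G S
    cover S F = let S′ , S′∈ , same = allEdgeSets-complete n S in
                S′ , S′∈ , IsForcingSet-cong G s t same F , card-cong G same

  OPTedge-realised : ∀ {u v t x} → _⇒_ G v t → IsOPTedge G s u v x → x ≡ ∞ ⊎ ForcingCard t x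
  OPTedge-realised v⇒t (_ , inj₁ (S , F , Suv , x≡)) = inj₂ (S , forcing-extend v⇒t F Suv , x≡)
  OPTedge-realised v⇒t (_ , inj₂ x≡∞)                = inj₁ x≡∞

  OPT-realised : ∀ {v t x} → _⇒_ G v t → IsOPT G s v x → x ≡ ∞ ⊎ ForcingCard t x
  OPT-realised {v} v⇒t (at-s , elsewhere) with v ≟ᶠ s
  ... | yes refl =
    inj₂ ((λ _ _ → false) , empty-forcing , trans (at-s refl) (sym (cong fin (card-empty G λ _ _ → refl))))
    where
    empty-forcing : IsForcingSet G s _ (λ _ _ → false)
    empty-forcing = let P , path , P-unique = v⇒t in
                    (λ _ _ ()) , P , (path , λ _ _ ()) , λ Q pathQ _ → P-unique Q pathQ
  ... | no v≢s with elsewhere v≢s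
  ...   | _ , inj₁ (_ , _ , opt) = OPTedge-realised v⇒t opt
  ...   | _ , inj₂ x≡∞           = inj₁ x≡∞

  OPT-attained : ∀ {t o} → IsMin (ForcingCard t) o → ForcingCard t o → ∃ λ v → _⇒_ G v t × IsOPT G s v o
  OPT-attained min (S , F , o≡) with forcing-lastEdge F
  ... | inj₁ (s⇒t , empty) =
    s , s⇒t , (λ _ → trans o≡ (cong fin (card-empty G empty))) , λ s≢s → ⊥-elim (s≢s refl)
  ... | inj₂ (u , v , Suv , v⇒t , Fv , v≢s) =
    v , v⇒t , (λ v≡s → ⊥-elim (v≢s v≡s)) ,
    λ _ → (λ _ (_ , _ , opt) → IsMin-≤ min (OPTedge-realised v⇒t opt)) ,
          inj₁ (u , proj₁ Fv u v Suv ,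
                (λ _ (S′ , F′ , S′uv , x≡) → IsMin-≤ min (inj₂ (S′ , forcing-extend v⇒t F′ S′uv , x≡))) ,
                inj₁ (S , Fv , Suv , o≡))

corollary1 : (n : ℕ) (G : Digraph n) (s t : Fin n) →
    Acyclic G → outdeg G s ≥ 2 →
    ∃ λ o → IsMin (λ x → ∃ λ S → IsForcingSet G s t S × x ≡ fin (card G S)) o
          × IsMin (λ x → ∃ λ v → _⇒_ G v t × IsOPT G s v x) o
corollary1 n G s t acyclic _ =
  o , min , (λ { x (v , v⇒t , opt) → IsMin-≤ min (OPT-realised v⇒t opt) }) ,
  [ (λ Ao → inj₁ (OPT-attained min Ao)) , inj₂ ]′ (proj₂ min)
  where
  open DAG G acyclic s
  o : ℕ∞
  o = proj₁ (forcingMin t)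

  min : IsMin (ForcingCard t) o
  min = proj₂ (forcingMin t)
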